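{- Let $n>1$, let $q,p_0,\ldots,p_{n-1}$ be non-zero integers with $\gcd(p_i,q)=1$ for all $i$, and assume $D:=q^n-p_0p_1\cdots p_{n-1}\neq 0$. For integers $j\ge 0$ put $U_j=\frac{q^j}{D}$. Let $\alpha,\beta$ be non-zero integers and $b$ an integer with $0<b<n$. If $\alpha U_0+\beta U_b$ is an integer, then $p_0p_1\cdots p_{n-1}\,\beta\, U_0+\alpha U_{n-b}$ is also an integer.
   Context: This is in the setting of compositions of maps $B_i(x)=\frac{p_ix+k_i}{q}$ ($i=0,\ldots,n-1$); the numbers $U_j=\frac{q^j}{q^n-p_0\cdots p_{n-1}}$ are defined there, the denominator being implicitly assumed non-zero. -}

module Defs where

open import Data.Nat as ℕ using (ℕ)
open import Data.Fin using (Fin; zero; suc)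
open import Data.Integer as ℤ using (ℤ; +_; 0ℤ; 1ℤ)
open import Data.Integer.GCD using (gcd)
import Data.Integer.Properties as ℤP
open import Data.Rational as ℚ using (ℚ; ↥_; 0ℚ)
import Data.Rational.Properties as ℚP
open import Data.Product using (∃-syntax)
open import Relation.Binary.PropositionalEquality
open import Relation.Nullary using (¬_)

prodFin : (n : ℕ) → (Fin n → ℤ) → ℤ
prodFin ℕ.zero    p = 1ℤ
prodFin (ℕ.suc n) p = p zero ℤ.* prodFin n (λ i → p (suc i))

Dq : (n : ℕ) → ℤ → (Fin n → ℤ) → ℤ
Dq n q p = q ℤ.^ n ℤ.- prodFin n p

toℚ : ℤ → ℚ
toℚ z = z ℚ./ 1

toℚ-nonZero : ∀ {z} → ¬ (z ≡ 0ℤ) → ℚ.NonZero (toℚ z)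
toℚ-nonZero {z} h = ℚ.≢-nonZero {toℚ z} λ eq →
  h (trans (sym (ℚP.↥-/ z 1))
     (trans (cong (λ r → ↥ r ℤ.* gcd z (+ 1)) eq) (ℤP.*-zeroˡ (gcd z (+ 1)))))

U : (n : ℕ) (q : ℤ) (p : Fin n → ℤ) → ¬ (Dq n q p ≡ 0ℤ) → ℕ → ℚ
U n q p hD j = ℚ._÷_ (toℚ (q ℤ.^ j)) (toℚ (Dq n q p)) {{toℚ-nonZero hD}}

IsInteger : ℚ → Set
IsInteger x = ∃[ z ] x ≡ toℚ z

{-# OPTIONS --safe #-}
-- Put X = q^(n-b) and Y = q^b, so that q^n = XY and D = XY - p₀⋯pₙ₋₁ =: XY - P.
-- Then Pβ + αX = X(α + βY) - βD, and dividing by D turns the hypothesis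
-- (α + βY)/D = z into (Pβ + αX)/D = Xz - β.
module Submission where

open import Defs
open import Data.Nat as ℕ using (ℕ)
open import Data.Fin using (Fin)
open import Data.Integer as ℤ using (ℤ; 0ℤ; 1ℤ; +_; -[1+_])
open import Data.Integer.GCD using (gcd)
open import Data.Rational as ℚ using (ℚ; mkℚ)
open import Data.Product using (_,_)
open import Relation.Binary.PropositionalEquality
  using (_≡_; refl; sym; trans; cong; cong₂; subst; module ≡-Reasoning)
open import Relation.Nullary using (¬_)
import Data.Nat.Coprimality as Coprimality
import Data.Nat.Properties as ℕP
import Data.Integer.Properties as ℤP
import Data.Rational.Properties as ℚP
import Data.Rational.Solver as ℚSolver
import Data.Integer.Solver as ℤSolver

coprimeTo-1 : ∀ z → Coprimality.Coprime ℤ.∣ z ∣ 1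
coprimeTo-1 z = Coprimality.sym (Coprimality.1-coprimeTo ℤ.∣ z ∣)

toℚ≡mkℚ : ∀ z → toℚ z ≡ mkℚ z 0 (coprimeTo-1 z)
toℚ≡mkℚ z = ℚP.↥p/↧p≡p _

toℚ-homo-+ : ∀ a b → toℚ (a ℤ.+ b) ≡ toℚ a ℚ.+ toℚ b
toℚ-homo-+ a b rewrite toℚ≡mkℚ a | toℚ≡mkℚ b =
  cong (ℚ._/ 1) (cong₂ ℤ._+_ (sym (ℤP.*-identityʳ a)) (sym (ℤP.*-identityʳ b)))

toℚ-homo-* : ∀ a b → toℚ (a ℤ.* b) ≡ toℚ a ℚ.* toℚ b
toℚ-homo-* a b rewrite toℚ≡mkℚ a | toℚ≡mkℚ b = refl

toℚ-homo‿- : ∀ a → toℚ (ℤ.- a) ≡ ℚ.- toℚ a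
toℚ-homo‿- a rewrite toℚ≡mkℚ (ℤ.- a) | toℚ≡mkℚ a = negate a
  where
  negate : ∀ a → mkℚ (ℤ.- a) 0 (coprimeTo-1 (ℤ.- a)) ≡ ℚ.- mkℚ a 0 (coprimeTo-1 a)
  negate (+ 0)       = refl
  negate (+ ℕ.suc _) = refl
  negate -[1+ _ ]    = refl

toℚ-homo-sub : ∀ a b → toℚ (a ℤ.- b) ≡ toℚ a ℚ.- toℚ b
toℚ-homo-sub a b = trans (toℚ-homo-+ a (ℤ.- b)) (cong (toℚ a ℚ.+_) (toℚ-homo‿- b))

^-split : ∀ q {b n} → b ℕ.≤ n → q ℤ.^ n ≡ q ℤ.^ (n ℕ.∸ b) ℤ.* q ℤ.^ b
^-split q {b} {n} b≤n =
  trans (cong (q ℤ.^_) (sym (ℕP.m∸n+n≡m b≤n))) (ℤP.^-distribˡ-+-* q (n ℕ.∸ b) b)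

module _ (D : ℤ) .{{_ : ℚ.NonZero (toℚ D)}} where

  *÷-+-*÷≡÷ : ∀ a x b y →
    toℚ a ℚ.* (toℚ x ℚ.÷ toℚ D) ℚ.+ toℚ b ℚ.* (toℚ y ℚ.÷ toℚ D)
      ≡ toℚ (a ℤ.* x ℤ.+ b ℤ.* y) ℚ.÷ toℚ D
  *÷-+-*÷≡÷ a x b y = begin
    toℚ a ℚ.* (toℚ x ℚ.* w) ℚ.+ toℚ b ℚ.* (toℚ y ℚ.* w)
      ≡⟨ solve 5 (λ a x b y w → a :* (x :* w) :+ b :* (y :* w) := (a :* x :+ b :* y) :* w)
               refl (toℚ a) (toℚ x) (toℚ b) (toℚ y) w ⟩
    (toℚ a ℚ.* toℚ x ℚ.+ toℚ b ℚ.* toℚ y) ℚ.* w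
      ≡⟨ cong (ℚ._* w) (sym (trans (toℚ-homo-+ (a ℤ.* x) (b ℤ.* y))
                                  (cong₂ ℚ._+_ (toℚ-homo-* a x) (toℚ-homo-* b y)))) ⟩
    toℚ (a ℤ.* x ℤ.+ b ℤ.* y) ℚ.* w ∎
    where
    open ≡-Reasoning
    open ℚSolver.+-*-Solver
    w = ℚ.1/ toℚ D

  IsInteger-÷⇒IsInteger-*-∸-*-÷ : ∀ x a c →
    IsInteger (toℚ a ℚ.÷ toℚ D) → IsInteger (toℚ (x ℤ.* a ℤ.- c ℤ.* D) ℚ.÷ toℚ D)
  IsInteger-÷⇒IsInteger-*-∸-*-÷ x a c (z , a/D≡z) = x ℤ.* z ℤ.- c , (begin
    toℚ (x ℤ.* a ℤ.- c ℤ.* D) ℚ.* w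
      ≡⟨ cong (ℚ._* w) (trans (toℚ-homo-sub (x ℤ.* a) (c ℤ.* D))
                              (cong₂ ℚ._-_ (toℚ-homo-* x a) (toℚ-homo-* c D))) ⟩
    (toℚ x ℚ.* toℚ a ℚ.- toℚ c ℚ.* toℚ D) ℚ.* w
      ≡⟨ solve 5 (λ x a c d w → (x :* a :- c :* d) :* w := x :* (a :* w) :- c :* (d :* w))
               refl (toℚ x) (toℚ a) (toℚ c) (toℚ D) w ⟩
    toℚ x ℚ.* (toℚ a ℚ.* w) ℚ.- toℚ c ℚ.* (toℚ D ℚ.* w)
      ≡⟨ cong₂ (λ s t → toℚ x ℚ.* s ℚ.- toℚ c ℚ.* t) a/D≡z (ℚP.*-inverseʳ (toℚ D)) ⟩
    toℚ x ℚ.* toℚ z ℚ.- toℚ c ℚ.* ℚ.1ℚ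
      ≡⟨ cong (λ t → toℚ x ℚ.* toℚ z ℚ.- t) (ℚP.*-identityʳ (toℚ c)) ⟩
    toℚ x ℚ.* toℚ z ℚ.- toℚ c
      ≡⟨ sym (trans (toℚ-homo-sub (x ℤ.* z) c) (cong (ℚ._- toℚ c) (toℚ-homo-* x z))) ⟩
    toℚ (x ℤ.* z ℤ.- c) ∎)
    where
    open ≡-Reasoning
    open ℚSolver.+-*-Solver
    w = ℚ.1/ toℚ D

-- The factors 1ℤ are the q⁰ of U₀.
swap-identity : ∀ P α β X Y →
  P ℤ.* β ℤ.* 1ℤ ℤ.+ α ℤ.* X ≡ X ℤ.* (α ℤ.* 1ℤ ℤ.+ β ℤ.* Y) ℤ.- β ℤ.* (X ℤ.* Y ℤ.- P)
swap-identity = solve 5 (λ P α β X Y →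
  P :* β :* con 1ℤ :+ α :* X := X :* (α :* con 1ℤ :+ β :* Y) :- β :* (X :* Y :- P)) refl
  where open ℤSolver.+-*-Solver

lemma2p1 : (n : ℕ) → 1 ℕ.< n → (q : ℤ) → (p : Fin n → ℤ) →
    ¬ (q ≡ 0ℤ) → (∀ i → ¬ (p i ≡ 0ℤ)) → (∀ i → gcd (p i) q ≡ 1ℤ) →
    (hD : ¬ (Dq n q p ≡ 0ℤ)) →
    (α β : ℤ) → ¬ (α ≡ 0ℤ) → ¬ (β ≡ 0ℤ) →
    (b : ℕ) → 0 ℕ.< b → b ℕ.< n →
    IsInteger (toℚ α ℚ.* U n q p hD 0 ℚ.+ toℚ β ℚ.* U n q p hD b) →
    IsInteger (toℚ (prodFin n p) ℚ.* toℚ β ℚ.* U n q p hD 0 ℚ.+ toℚ α ℚ.* U n q p hD (n ℕ.∸ b))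
lemma2p1 n _ q p _ _ _ hD α β _ _ b _ b<n αU₀+βU_b-integral =
  subst IsInteger (sym goal-as-fraction)
    (subst (λ m → IsInteger (toℚ m ℚ.÷ toℚ D)) (sym numerator-identity)
      (IsInteger-÷⇒IsInteger-*-∸-*-÷ D X (α ℤ.* 1ℤ ℤ.+ β ℤ.* Y) β
        (subst IsInteger (*÷-+-*÷≡÷ D α 1ℤ β Y) αU₀+βU_b-integral)))
  where
  instance _ = toℚ-nonZero hD
  P = prodFin n p
  D = Dq n q p
  X = q ℤ.^ (n ℕ.∸ b)
  Y = q ℤ.^ b
  numerator-identity : P ℤ.* β ℤ.* 1ℤ ℤ.+ α ℤ.* X ≡ X ℤ.* (α ℤ.* 1ℤ ℤ.+ β ℤ.* Y) ℤ.- β ℤ.* D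
  numerator-identity = trans (swap-identity P α β X Y)
    (cong (λ qⁿ → X ℤ.* (α ℤ.* 1ℤ ℤ.+ β ℤ.* Y) ℤ.- β ℤ.* (qⁿ ℤ.- P)) (sym (^-split q (ℕP.<⇒≤ b<n))))
  goal-as-fraction : toℚ P ℚ.* toℚ β ℚ.* U n q p hD 0 ℚ.+ toℚ α ℚ.* U n q p hD (n ℕ.∸ b)
                   ≡ toℚ (P ℤ.* β ℤ.* 1ℤ ℤ.+ α ℤ.* X) ℚ.÷ toℚ D
  goal-as-fraction = trans (cong (λ r → r ℚ.* U n q p hD 0 ℚ.+ toℚ α ℚ.* U n q p hD (n ℕ.∸ b))
                                 (sym (toℚ-homo-* P β)))
                           (*÷-+-*÷≡÷ D (P ℤ.* β) 1ℤ α X)
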